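{- The maps $\phi_k \colon S_{n-1} \times [n] \rightarrow S_n$ and $\psi_k \colon S_n \rightarrow S_{n-1} \times [n]$ are inverse to one another.
   Context: Here $[n]=\{1,\dots,n\}$ and $k>1$. Permutations are written in canonical cycle notation $\pi = (c^{(t)}_1\cdots c^{(t)}_{\ell_t}) \cdots (c^{(1)}_1\cdots c^{(1)}_{\ell_1})$, where cycle $c^{(i)} = (c^{(i)}_1 \cdots c^{(i)}_{\ell_i})$ has $\ell_i$ letters, the first letter $c^{(i)}_1$ of each cycle is the largest letter in that cycle, and $c^{(i+1)}_1 < c^{(i)}_1$ for all $i$ (so $c^{(1)}$ is the rightmost cycle, containing the largest letter). When $\phi_k(\pi,x)$ is formed, the letters of $\pi$ that are $\geq x$ are first incremented by one. The maps are defined recursively, simultaneously. $\phi_k(\emptyset, 1) = (1)$, and for $n>1$, $\pi \in S_{n-1}$, $x \in [n]$: - $\phi_k(\pi,x) = c^{(t)} \cdots c^{(1)}(x)$ if $x > c^{(1)}_1$; - $\phi_k(\pi,x) = \phi_k(c^{(t)} \cdots c^{(2)}, c^{(1)}_2)(c^{(1)}_1 c^{(1)}_3 \cdots c^{(1)}_{k} x)$ if $\ell_1 = k$; - $\phi_k(\pi,x) = \pi' (c^{(1)}_1 x' c^{(1)}_2\cdots c^{(1)}_{k-1} x)$ if $\ell_1 = k-1$ and $t > 1$; - $\phi_k(\pi,x) = c^{(t)} \cdots c^{(2)} (c^{(1)}_1 \cdots c^{(1)}_{\ell_1} x)$ otherwise. $\psi_k \colon S_n \to S_{n-1}\times[n]$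 is defined by: - $\psi_k(\pi) = (c^{(t)} \cdots c^{(2)}, c^{(1)}_1)$ if $\ell_1 = 1$; - $\psi_k(\pi) = (\phi_k(c^{(t)} \cdots c^{(2)}, c_2^{(1)})(c^{(1)}_1 c^{(1)}_3 \cdots c^{(1)}_k), c^{(1)}_{k+1})$ if $\ell_1 = k + 1$; - $\psi_k(\pi) = (\pi'(c^{(1)}_1 x' c^{(1)}_2 \cdots c^{(1)}_{k-1}), c^{(1)}_k)$ if $\ell_1 = k$ and $t > 1$; - $\psi_k(\pi) = (c^{(t)} \cdots c^{(2)}(c^{(1)}_1\cdots c^{(1)}_{\ell_1-1}),c^{(1)}_{\ell_1})$ otherwise. In both functions, $(\pi', x') = \psi_k(c^{(t)}\cdots c^{(2)})$. -}

module Defs where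

open import Data.Nat using (ℕ; zero; suc; _+_; _∸_; _≤_; _<_; _<ᵇ_; _≡ᵇ_)
open import Data.Bool using (Bool; true; false; if_then_else_; _∧_; not)
open import Data.List using (List; []; _∷_; _++_; map; length; concat; upTo)
open import Data.List.Relation.Unary.All using (All)
open import Data.List.Relation.Unary.Linked using (Linked)
open import Data.List.Relation.Binary.Permutation.Propositional using (_↭_)
open import Data.Product using (Σ; ∃; _×_; _,_; proj₁; proj₂)
open import Relation.Binary.PropositionalEquality using (_≡_)

-- A permutation  π = c^(t) ⋯ c^(2) c^(1)  is represented by the list of
-- its cycles written from RIGHT to LEFT, i.e. as
--     c^(1) ∷ c^(2) ∷ ⋯ ∷ c^(t) ∷ []
-- so the head of the list is the cycle c^(1) containing the largest
-- letter.

Cycle : Set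
Cycle = List ℕ

Cycles : Set
Cycles = List Cycle

-- first letter of a cycle (dummy 0 for the empty list, never used on
-- valid data)
first : Cycle → ℕ
first []      = 0
first (a ∷ _) = a

CanonicalCycle : Cycle → Set
CanonicalCycle c = ∃ λ h → ∃ λ rest → (c ≡ h ∷ rest) × All (_< h) rest

range : ℕ → List ℕ
range n = map suc (upTo n)

Canonical : ℕ → Cycles → Set
Canonical n cs =
  All CanonicalCycle cs
  × Linked (λ a b → b < a) (map first cs)
  × (concat cs ↭ range n)

splitLast : List ℕ → List ℕ × ℕ
splitLast []       = [] , 0
splitLast (a ∷ []) = [] , a
splitLast (a ∷ b ∷ l) with splitLast (b ∷ l)
... | (i , z) = (a ∷ i) , z

isEmpty : Cycles → Bool
isEmpty []      = true
isEmpty (_ ∷ _) = false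

-- The maps φ_k and ψ_k on permutations of an arbitrary finite set of
-- letters (no relabelling).  φ′ k cs x  assumes the letter x does not
-- occur in cs; ψ′ k cs  returns the permutation with one letter removed
-- together with the removed letter.  The recursive calls in the paper
-- (on c^(t)⋯c^(2), whose letters are not {1,…,m}) are read in this
-- relabelling-free way.

mutual
  φ′ : ℕ → Cycles → ℕ → Cycles
  φ′ k [] x = (x ∷ []) ∷ []
  φ′ k (c ∷ rest) x =
    if first c <ᵇ x
    then (x ∷ []) ∷ c ∷ rest
    else if length c ≡ᵇ k
    then φ′-ℓ≡k k c rest x
    else if (length c ≡ᵇ k ∸ 1) ∧ not (isEmpty rest)
    then φ′-ℓ≡k-1 k c rest x
    else (c ++ (x ∷ [])) ∷ rest

  φ′-ℓ≡k : ℕ → Cycle → Cycles → ℕ → Cycles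
  φ′-ℓ≡k k (c₁ ∷ c₂ ∷ more) rest x = (c₁ ∷ (more ++ (x ∷ []))) ∷ φ′ k rest c₂
  φ′-ℓ≡k k c rest x = (c ++ (x ∷ [])) ∷ rest   -- unreachable since k > 1

  φ′-ℓ≡k-1 : ℕ → Cycle → Cycles → ℕ → Cycles
  φ′-ℓ≡k-1 k (c₁ ∷ cs) rest x with ψ′ k rest
  ... | (π′ , x′) = (c₁ ∷ x′ ∷ (cs ++ (x ∷ []))) ∷ π′
  φ′-ℓ≡k-1 k [] rest x = (x ∷ []) ∷ rest        -- unreachable

  ψ′ : ℕ → Cycles → Cycles × ℕ
  ψ′ k [] = [] , 0                              -- unreachable
  ψ′ k (c ∷ rest) =
    if length c ≡ᵇ 1
    then (rest , first c)
    else if length c ≡ᵇ suc k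
    then ψ′-ℓ≡k+1 k c rest
    else if (length c ≡ᵇ k) ∧ not (isEmpty rest)
    then ψ′-ℓ≡k k c rest
    else (proj₁ (splitLast c) ∷ rest , proj₂ (splitLast c))

  ψ′-ℓ≡k+1 : ℕ → Cycle → Cycles → Cycles × ℕ
  ψ′-ℓ≡k+1 k (c₁ ∷ c₂ ∷ more) rest =
    ((c₁ ∷ proj₁ (splitLast more)) ∷ φ′ k rest c₂) , proj₂ (splitLast more)
  ψ′-ℓ≡k+1 k c rest = (rest , 0)                -- unreachable

  ψ′-ℓ≡k : ℕ → Cycle → Cycles → Cycles × ℕ
  ψ′-ℓ≡k k (c₁ ∷ cs) rest with ψ′ k rest
  ... | (π′ , x′) = ((c₁ ∷ x′ ∷ proj₁ (splitLast cs)) ∷ π′) , proj₂ (splitLast cs)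
  ψ′-ℓ≡k k [] rest = (rest , 0)                 -- unreachable

incFrom : ℕ → Cycles → Cycles
incFrom x = map (map (λ a → if a <ᵇ x then a else suc a))

decAbove : ℕ → Cycles → Cycles
decAbove y = map (map (λ a → if y <ᵇ a then a ∸ 1 else a))

-- φ_k : S_{n-1} × [n] → S_n   (letters ≥ x of π are first incremented)
φ : ℕ → Cycles → ℕ → Cycles
φ k π x = φ′ k (incFrom x π) x

-- ψ_k : S_n → S_{n-1} × [n]   (the removed letter y is returned and the
-- remaining letters are standardised back to [n-1])
ψ : ℕ → Cycles → Cycles × ℕ
ψ k σ = decAbove (proj₂ (ψ′ k σ)) (proj₁ (ψ′ k σ)) , proj₂ (ψ′ k σ)

{-# OPTIONS --safe #-}
-- The maps φ′ k and ψ′ k act on cycle lists over any set of distinct letters, and φ, ψ only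
-- conjugate them by the order-preserving relabellings incLetter x and decLetter y, which keep
-- cycle notation canonical. The core is a simultaneous induction on the cycle list showing that
-- ψ′ undoes φ′ and φ′ undoes ψ′, clause by clause: a new singleton cycle is removed by the
-- ℓ₁ = 1 clause; the ℓ₁ = k clause of φ′ leaves a leading cycle of length k, undone by the
-- ℓ₁ = k clause of ψ′; the ℓ₁ = k − 1 clause of φ′ leaves one of length k + 1, undone by the
-- ℓ₁ = k + 1 clause of ψ′; the remaining clauses append and remove a last letter. Since the
-- recursive calls swap φ′ and ψ′, each half of the induction needs the other.
module Submission where

open import Defs
open import Data.Bool using (true; false; if_then_else_; _∧_; not)
open import Data.Bool.Properties using (∧-zeroʳ)
open import Data.Empty using (⊥-elim)
open import Data.List using (List; []; _∷_; _++_; _∷ʳ_; map; length; concat; upTo; initLast; _∷ʳ′_)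
open import Data.List.Properties using (++-assoc; length-++; map-++; map-∘; map-id-local; concat-map; upTo-∷ʳ)
open import Data.List.Relation.Unary.All as All using (All; []; _∷_)
open import Data.List.Relation.Unary.All.Properties as All using (all-upTo; concat⁻; ∷ʳ⁺; ∷ʳ⁻)
open import Data.List.Relation.Unary.AllPairs using (_∷_)
open import Data.List.Relation.Unary.Linked as Linked using (Linked; []; [-]; _∷_)
open import Data.List.Relation.Unary.Unique.Propositional using (Unique)
import Data.List.Relation.Unary.Unique.Propositional.Properties as Unique
open import Data.List.Relation.Binary.Permutation.Propositional
  using (_↭_; ↭-refl; ↭-reflexive; ↭-sym; ↭-trans; ↭-prep; ↭⇒↭ₛ; module PermutationReasoning)
open import Data.List.Relation.Binary.Permutation.Propositional.Properties
  using (shift; ++⁺ˡ; ++⁺ʳ; All-resp-↭; drop-∷; map⁺; ∷↭∷ʳ; ¬x∷xs↭[])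
import Data.List.Relation.Binary.Permutation.Setoid.Properties as SetoidPermutation
open import Data.Nat using (ℕ; zero; suc; _∸_; _≤_; _<_; _>_; _≮_; _<ᵇ_; _≡ᵇ_; z≤n; s≤s)
open import Data.Nat.Properties
open import Data.Product using (_×_; _,_; proj₁; proj₂)
open import Data.Sum using (inj₁; inj₂)
open import Data.Unit using (⊤)
open import Function using (_∘_)
open import Relation.Binary.PropositionalEquality
open import Relation.Nullary using (¬_; yes; no; proof)
open import Relation.Nullary.Reflects using (Reflects; ofʸ; ofⁿ)

private
  variable
    A : Set
    a b h m n x y z : ℕ
    t xs ys zs : List ℕ
    cs rest π σ : Cycles

reflects⇒≡true : ∀ {P : Set} {d} → Reflects P d → P → d ≡ true
reflects⇒≡true (ofʸ _)  _ = refl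
reflects⇒≡true (ofⁿ ¬p) p = ⊥-elim (¬p p)

reflects⇒≡false : ∀ {P : Set} {d} → Reflects P d → ¬ P → d ≡ false
reflects⇒≡false (ofʸ p) ¬p = ⊥-elim (¬p p)
reflects⇒≡false (ofⁿ _) _  = refl

<ᵇ≡true : m < n → (m <ᵇ n) ≡ true
<ᵇ≡true {m} {n} = reflects⇒≡true (<ᵇ-reflects-< m n)

<ᵇ≡false : m ≮ n → (m <ᵇ n) ≡ false
<ᵇ≡false {m} {n} = reflects⇒≡false (<ᵇ-reflects-< m n)

≡ᵇ≡true : m ≡ n → (m ≡ᵇ n) ≡ true
≡ᵇ≡true {m} {n} = reflects⇒≡true (proof (m ≟ n))

≡ᵇ≡false : m ≢ n → (m ≡ᵇ n) ≡ false
≡ᵇ≡false {m} {n} = reflects⇒≡false (proof (m ≟ n))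

≡ᵇ∧nonEmpty≡false : ¬ (m ≡ n × isEmpty cs ≡ false) → ((m ≡ᵇ n) ∧ not (isEmpty cs)) ≡ false
≡ᵇ∧nonEmpty≡false {m} {n} {cs = []}    _  = ∧-zeroʳ (m ≡ᵇ n)
≡ᵇ∧nonEmpty≡false         {cs = _ ∷ _} ¬p rewrite ≡ᵇ≡false (λ m≡n → ¬p (m≡n , refl)) = refl

length-∷ʳ : ∀ (xs : List A) x → length (xs ∷ʳ x) ≡ suc (length xs)
length-∷ʳ xs x = trans (length-++ xs) (+-comm (length xs) 1)

splitLast-∷ʳ : ∀ xs z → splitLast (xs ∷ʳ z) ≡ (xs , z)
splitLast-∷ʳ []           z = refl
splitLast-∷ʳ (a ∷ [])     z = refl
splitLast-∷ʳ (a ∷ b ∷ xs) z rewrite splitLast-∷ʳ (b ∷ xs) z = refl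

unique-++⁻ʳ : ∀ (xs : List A) {ys} → Unique (xs ++ ys) → Unique ys
unique-++⁻ʳ []       u       = u
unique-++⁻ʳ (x ∷ xs) (_ ∷ u) = unique-++⁻ʳ xs u

unique-resp-↭ : xs ↭ ys → Unique xs → Unique ys
unique-resp-↭ p = SetoidPermutation.Unique-resp-↭ (setoid ℕ) (↭⇒↭ₛ p)

∷ʳ-++-↭ : ∀ (xs : List A) x ys → (xs ∷ʳ x) ++ ys ↭ x ∷ xs ++ ys
∷ʳ-++-↭ xs x ys = ↭-trans (↭-reflexive (++-assoc xs (x ∷ []) ys)) (shift x xs ys)

++-↭-∷ : ∀ (xs : List A) {ys y zs} → ys ↭ y ∷ zs → xs ++ ys ↭ y ∷ xs ++ zs
++-↭-∷ xs {y = y} {zs} p = ↭-trans (++⁺ˡ xs p) (shift y xs zs)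

isEmpty-concat-↭ : concat cs ↭ x ∷ xs → isEmpty cs ≡ false
isEmpty-concat-↭ {cs = []}    p = ⊥-elim (¬x∷xs↭[] (↭-sym p))
isEmpty-concat-↭ {cs = _ ∷ _} _ = refl

data Ordered : Cycles → Set where
  []   : Ordered []
  cons : All (_< h) t → All (_< h) (concat rest) → Ordered rest → Ordered ((h ∷ t) ∷ rest)

ordered-letters-< : Ordered ((h ∷ t) ∷ rest) → h < x → All (_< x) (concat ((h ∷ t) ∷ rest))
ordered-letters-< (cons t<h rest<h _) h<x =
  h<x ∷ All.++⁺ (All.map (λ a<h → <-trans a<h h<x) t<h) (All.map (λ a<h → <-trans a<h h<x) rest<h)

canonical⇒ordered : Canonical n cs → Ordered cs
canonical⇒ordered (ccs , lk , _) = ordered ccs lk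
  where
  below : Ordered rest → Linked _>_ (h ∷ map first rest) → All (_< h) (concat rest)
  below []             _          = []
  below o@(cons _ _ _) (h′<h ∷ _) = ordered-letters-< o h′<h
  ordered : All CanonicalCycle cs → Linked _>_ (map first cs) → Ordered cs
  ordered []                            _  = []
  ordered ((h , t , refl , t<h) ∷ ccs) lk = cons t<h (below ord lk) ord
    where ord = ordered ccs (Linked.tail lk)

ordered⇒canonical : Ordered cs → concat cs ↭ range n → Canonical n cs
ordered⇒canonical ord letters = cycles ord , linked ord , letters
  where
  cycles : Ordered cs → All CanonicalCycle cs
  cycles []               = []
  cycles (cons t<h _ ord) = (_ , _ , refl , t<h) ∷ cycles ord
  linked : Ordered cs → Linked _>_ (map first cs)
  linked []                                 = []
  linked (cons _ _ [])                      = [-]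
  linked (cons _ (h′<h ∷ _) o@(cons _ _ _)) = h′<h ∷ linked o

incLetter : ℕ → ℕ → ℕ
incLetter x a = if a <ᵇ x then a else suc a

decLetter : ℕ → ℕ → ℕ
decLetter y a = if y <ᵇ a then a ∸ 1 else a

incLetter-< : a < x → incLetter x a ≡ a
incLetter-< a<x rewrite <ᵇ≡true a<x = refl

incLetter-≮ : a ≮ x → incLetter x a ≡ suc a
incLetter-≮ a≮x rewrite <ᵇ≡false a≮x = refl

decLetter-incLetter : ∀ x a → decLetter x (incLetter x a) ≡ a
decLetter-incLetter x a with a <? x
... | yes a<x rewrite <ᵇ≡true a<x  | <ᵇ≡false (<⇒≯ a<x)      = refl
... | no  a≮x rewrite <ᵇ≡false a≮x | <ᵇ≡true (s≤s (≮⇒≥ a≮x)) = refl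

incLetter-decLetter : y ≢ a → incLetter y (decLetter y a) ≡ a
incLetter-decLetter {y} {a} y≢a with y <? a
incLetter-decLetter {y} {suc a} _   | yes y<1+a
  rewrite <ᵇ≡true y<1+a | <ᵇ≡false (≤⇒≯ (≤-pred y<1+a)) = refl
incLetter-decLetter {y} {a}     y≢a | no  y≮a
  rewrite <ᵇ≡false y≮a | <ᵇ≡true (≤∧≢⇒< (≮⇒≥ y≮a) (y≢a ∘ sym)) = refl

incLetter-injective : ∀ x {a b} → incLetter x a ≡ incLetter x b → a ≡ b
incLetter-injective x {a} {b} e =
  trans (sym (decLetter-incLetter x a)) (trans (cong (decLetter x) e) (decLetter-incLetter x b))

incLetter-≢ : ∀ x a → x ≢ incLetter x a
incLetter-≢ x a with a <? x
... | yes a<x rewrite <ᵇ≡true a<x  = >⇒≢ a<x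
... | no  a≮x rewrite <ᵇ≡false a≮x = <⇒≢ (s≤s (≮⇒≥ a≮x))

incLetter-mono-< : a < b → incLetter x a < incLetter x b
incLetter-mono-< {a} {b} {x} a<b with a <? x | b <? x
... | yes a<x | yes b<x rewrite <ᵇ≡true a<x  | <ᵇ≡true b<x  = a<b
... | yes a<x | no  b≮x rewrite <ᵇ≡true a<x  | <ᵇ≡false b≮x = m<n⇒m<1+n a<b
... | no  a≮x | yes b<x = ⊥-elim (a≮x (<-trans a<b b<x))
... | no  a≮x | no  b≮x rewrite <ᵇ≡false a≮x | <ᵇ≡false b≮x = s≤s a<b

decLetter-mono-< : y ≢ a → y ≢ b → a < b → decLetter y a < decLetter y b
decLetter-mono-< {y} {a} {b} y≢a y≢b a<b with y <? a | y <? b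
decLetter-mono-< {y} {suc a} {suc b} _ _ a<b | yes y<a | yes y<b
  rewrite <ᵇ≡true y<a | <ᵇ≡true y<b = ≤-pred a<b
decLetter-mono-< _ _ a<b | yes y<a | no y≮b = ⊥-elim (y≮b (<-trans y<a a<b))
decLetter-mono-< {y} {a} {suc b} y≢a _ a<b | no y≮a | yes y<b
  rewrite <ᵇ≡false y≮a | <ᵇ≡true y<b = <-≤-trans (≤∧≢⇒< (≮⇒≥ y≮a) (y≢a ∘ sym)) (≤-pred y<b)
decLetter-mono-< _ _ a<b | no y≮a | no y≮b
  rewrite <ᵇ≡false y≮a | <ᵇ≡false y≮b = a<b

map-ordered : ∀ {P : ℕ → Set} (f : ℕ → ℕ) → (∀ {a b} → P a → P b → a < b → f a < f b) →
              All P (concat cs) → Ordered cs → Ordered (map (map f) cs)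
map-ordered f mono _ [] = []
map-ordered {P = P} f mono (ph ∷ ps) (cons {h} {t} {rest} t<h rest<h ord) =
  cons (mono-below t (All.++⁻ˡ t ps) t<h)
       (subst (All (_< f h)) (sym (concat-map rest)) (mono-below (concat rest) (All.++⁻ʳ t ps) rest<h))
       (map-ordered f mono (All.++⁻ʳ t ps) ord)
  where
  mono-below : ∀ xs → All P xs → All (_< h) xs → All (_< f h) (map f xs)
  mono-below xs pxs xs<h = All.map⁺ (All.zipWith (λ (pa , a<h) → mono pa ph a<h) (pxs , xs<h))

map-inverse : ∀ {P : ℕ → Set} {f g : ℕ → ℕ} → (∀ {a} → P a → g (f a) ≡ a) →
              All P xs → map g (map f xs) ≡ xs
map-inverse {xs} inv ps = trans (sym (map-∘ xs)) (map-id-local (All.map inv ps))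

map-map-inverse : ∀ {P : ℕ → Set} {f g : ℕ → ℕ} → (∀ {a} → P a → g (f a) ≡ a) →
                  All P (concat cs) → map (map g) (map (map f) cs) ≡ cs
map-map-inverse {cs} inv ps =
  trans (sym (map-∘ cs)) (map-id-local (All.map (map-inverse inv) (concat⁻ ps)))

decAbove-incFrom : ∀ x cs → decAbove x (incFrom x cs) ≡ cs
decAbove-incFrom x cs =
  map-map-inverse {P = λ _ → ⊤} (λ {a} _ → decLetter-incLetter x a) (All.universal _ (concat cs))

incFrom-decAbove : All (y ≢_) (concat cs) → incFrom y (decAbove y cs) ≡ cs
incFrom-decAbove = map-map-inverse incLetter-decLetter

incFrom-ordered : ∀ x → Ordered cs → Ordered (incFrom x cs)
incFrom-ordered {cs} x =
  map-ordered {P = λ _ → ⊤} (incLetter x) (λ _ _ → incLetter-mono-< {x = x}) (All.universal _ (concat cs))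

incFrom-unique : ∀ x cs → Unique (concat cs) → Unique (concat (incFrom x cs))
incFrom-unique x cs u = subst Unique (sym (concat-map cs)) (Unique.map⁺ (incLetter-injective x) u)

incFrom-fresh : ∀ x cs → All (x ≢_) (concat (incFrom x cs))
incFrom-fresh x cs =
  subst (All (x ≢_)) (sym (concat-map cs)) (All.map⁺ (All.universal (incLetter-≢ x) (concat cs)))

decAbove-ordered : All (y ≢_) (concat cs) → Ordered cs → Ordered (decAbove y cs)
decAbove-ordered = map-ordered (decLetter _) decLetter-mono-<

range-suc : ∀ n → range (suc n) ≡ range n ∷ʳ suc n
range-suc n = trans (cong (map suc) (sym (upTo-∷ʳ n))) (map-++ suc (upTo n) (n ∷ []))

range-unique : ∀ n → Unique (range n)
range-unique n = Unique.map⁺ suc-injective (Unique.upTo⁺ n)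

range-bounds : ∀ n → All (λ a → 1 ≤ a × a ≤ n) (range n)
range-bounds n = All.map⁺ (All.map (λ i<n → s≤s z≤n , i<n) (all-upTo n))

incLetter-range : ∀ {n x} → n < x → map (incLetter x) (range n) ≡ range n
incLetter-range {x = x} n<x =
  map-id-local (All.map (λ (_ , a≤n) → incLetter-< {x = x} (≤-<-trans a≤n n<x)) (range-bounds _))

range-insert : ∀ m {x} → 1 ≤ x → x ≤ suc m → x ∷ map (incLetter x) (range m) ↭ range (suc m)
range-insert m         _   x≤1+m with m≤n⇒m<n∨m≡n x≤1+m
range-insert m         _   _ | inj₂ refl = begin
  suc m ∷ map (incLetter (suc m)) (range m) ≡⟨ cong (suc m ∷_) (incLetter-range ≤-refl) ⟩
  suc m ∷ range m                           ↭⟨ ∷↭∷ʳ (suc m) (range m) ⟩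
  range m ∷ʳ suc m                          ≡⟨ range-suc m ⟨
  range (suc m)                             ∎
  where open PermutationReasoning
range-insert zero      (s≤s _) _ | inj₁ (s≤s ())
range-insert (suc m) {x} 1≤x _   | inj₁ (s≤s x≤1+m) = begin
  x ∷ map (incLetter x) (range (suc m))
    ≡⟨ cong (λ l → x ∷ map (incLetter x) l) (range-suc m) ⟩
  x ∷ map (incLetter x) (range m ∷ʳ suc m)
    ≡⟨ cong (x ∷_) (map-++ (incLetter x) (range m) (suc m ∷ [])) ⟩
  (x ∷ map (incLetter x) (range m)) ∷ʳ incLetter x (suc m)
    ≡⟨ cong ((x ∷ map (incLetter x) (range m)) ∷ʳ_) (incLetter-≮ (≤⇒≯ x≤1+m)) ⟩
  (x ∷ map (incLetter x) (range m)) ∷ʳ suc (suc m)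
    ↭⟨ ++⁺ʳ (suc (suc m) ∷ []) (range-insert m 1≤x x≤1+m) ⟩
  range (suc m) ∷ʳ suc (suc m)
    ≡⟨ range-suc (suc m) ⟨
  range (suc (suc m))
    ∎
  where open PermutationReasoning

range-remove : y ∷ xs ↭ range (suc m) →
               All (y ≢_) xs × 1 ≤ y × y ≤ suc m × xs ↭ map (incLetter y) (range m)
range-remove {y} {xs} {m} y∷xs↭
  with y∉ ∷ _ ← unique-resp-↭ (↭-sym y∷xs↭) (range-unique (suc m))
  with (1≤y , y≤1+m) ∷ _ ← All-resp-↭ (↭-sym y∷xs↭) (range-bounds (suc m)) =
  y∉ , 1≤y , y≤1+m , drop-∷ (↭-trans y∷xs↭ (↭-sym (range-insert m 1≤y y≤1+m)))

decAbove-range : ∀ y cs → concat cs ↭ map (incLetter y) (range m) →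
                 concat (decAbove y cs) ↭ range m
decAbove-range {m} y cs cs↭ = begin
  concat (decAbove y cs)                           ≡⟨ concat-map cs ⟩
  map (decLetter y) (concat cs)                    ↭⟨ map⁺ (decLetter y) cs↭ ⟩
  map (decLetter y) (map (incLetter y) (range m))  ≡⟨ map-inverse {P = λ _ → ⊤} (λ {a} _ → decLetter-incLetter y a)
                                                                  (All.universal _ (range m)) ⟩
  range m                                          ∎
  where open PermutationReasoning

module Bijection (j : ℕ) where

  k : ℕ
  k = suc (suc j)

  φ′-eq-new : h < x → φ′ k ((h ∷ t) ∷ rest) x ≡ (x ∷ []) ∷ (h ∷ t) ∷ rest
  φ′-eq-new h<x rewrite <ᵇ≡true h<x = refl

  φ′-eq-ℓ≡k : ∀ {c more} → x < h → length more ≡ j →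
              φ′ k ((h ∷ c ∷ more) ∷ rest) x ≡ (h ∷ (more ∷ʳ x)) ∷ φ′ k rest c
  φ′-eq-ℓ≡k x<h ℓ rewrite <ᵇ≡false (<⇒≯ x<h) | ℓ | ≡ᵇ≡true {j} refl = refl

  φ′-eq-ℓ≡k∸1 : x < h → length t ≡ j → isEmpty rest ≡ false →
                φ′ k ((h ∷ t) ∷ rest) x ≡ (h ∷ proj₂ (ψ′ k rest) ∷ (t ∷ʳ x)) ∷ proj₁ (ψ′ k rest)
  φ′-eq-ℓ≡k∸1 x<h ℓ ne
    rewrite <ᵇ≡false (<⇒≯ x<h) | ℓ | ≡ᵇ≡false {j} (1+n≢n ∘ sym) | ≡ᵇ≡true {j} refl | ne = refl

  φ′-eq-other : x < h → length t ≢ suc j → ¬ (length t ≡ j × isEmpty rest ≡ false) →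
                φ′ k ((h ∷ t) ∷ rest) x ≡ (h ∷ (t ∷ʳ x)) ∷ rest
  φ′-eq-other x<h ℓ≢k ¬k∸1
    rewrite <ᵇ≡false (<⇒≯ x<h) | ≡ᵇ≡false ℓ≢k | ≡ᵇ∧nonEmpty≡false ¬k∸1 = refl

  φ′-above : Ordered cs → All (_< x) (concat cs) → φ′ k cs x ≡ (x ∷ []) ∷ cs
  φ′-above []           _         = refl
  φ′-above (cons _ _ _) (h<x ∷ _) = φ′-eq-new h<x

  ψ′-eq-ℓ≡k+1 : ∀ {c more} → length more ≡ j →
                ψ′ k ((h ∷ c ∷ (more ∷ʳ z)) ∷ rest) ≡ ((h ∷ more) ∷ φ′ k rest c , z)
  ψ′-eq-ℓ≡k+1 {z = z} {more = more} ℓ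
    rewrite length-∷ʳ more z | ℓ | ≡ᵇ≡true {j} refl | splitLast-∷ʳ more z = refl

  ψ′-eq-ℓ≡k : length t ≡ j → isEmpty rest ≡ false →
              ψ′ k ((h ∷ (t ∷ʳ z)) ∷ rest) ≡ ((h ∷ proj₂ (ψ′ k rest) ∷ t) ∷ proj₁ (ψ′ k rest) , z)
  ψ′-eq-ℓ≡k {t = t} {z = z} ℓ ne
    rewrite length-∷ʳ t z | ℓ | ≡ᵇ≡false {j} (1+n≢n ∘ sym) | ≡ᵇ≡true {j} refl | ne
          | splitLast-∷ʳ t z = refl

  ψ′-eq-other : length t ≢ suc j → ¬ (length t ≡ j × isEmpty rest ≡ false) →
                ψ′ k ((h ∷ (t ∷ʳ z)) ∷ rest) ≡ ((h ∷ t) ∷ rest , z)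
  ψ′-eq-other {t = t} {h = h} {z = z} ℓ≢k ¬k∸1
    rewrite length-∷ʳ t z | ≡ᵇ≡false ℓ≢k | ≡ᵇ∧nonEmpty≡false ¬k∸1 | splitLast-∷ʳ (h ∷ t) z = refl

  -- The clause of φ′ k taken at a leading cycle h ∷ t, for a letter below h, and the clause
  -- of ψ′ k taken at the leading cycle h ∷ (t ∷ʳ z) are decided by the same case split.
  data LengthCase : List ℕ → Cycles → Set where
    ℓ≡k   : ∀ {c more rest} → length more ≡ j → LengthCase (c ∷ more) rest
    ℓ≡k∸1 : ∀ {t r rs} → length t ≡ j → LengthCase t (r ∷ rs)
    other : ∀ {t rest} → length t ≢ suc j → ¬ (length t ≡ j × isEmpty rest ≡ false) →
            LengthCase t rest

  lengthCase : ∀ t rest → LengthCase t rest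
  lengthCase t rest with length t ≟ suc j
  lengthCase []         _ | yes ()
  lengthCase (c ∷ more) _ | yes ℓ = ℓ≡k (suc-injective ℓ)
  lengthCase t rest | no ℓ≢k with length t ≟ j | rest
  ... | yes ℓ    | _ ∷ _ = ℓ≡k∸1 ℓ
  ... | yes _    | []    = other ℓ≢k λ ()
  ... | no ℓ≢k∸1 | _     = other ℓ≢k (ℓ≢k∸1 ∘ proj₁)

  φ′-Invertible : Cycles → ℕ → Set
  φ′-Invertible cs x =
    Ordered (φ′ k cs x) × concat (φ′ k cs x) ↭ x ∷ concat cs × ψ′ k (φ′ k cs x) ≡ (cs , x)

  ψ′-Invertible : Cycles → Set
  ψ′-Invertible σ = let (p , y) = ψ′ k σ in Ordered p × concat σ ↭ y ∷ concat p × φ′ k p y ≡ σ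

  φ′-invertible-from : ∀ {σ} → φ′ k cs x ≡ σ →
                       Ordered σ → concat σ ↭ x ∷ concat cs → ψ′ k σ ≡ (cs , x) → φ′-Invertible cs x
  φ′-invertible-from refl ord letters inverse = ord , letters , inverse

  ψ′-invertible-from : ∀ {σ p} → ψ′ k σ ≡ (p , y) →
                       Ordered p → concat σ ↭ y ∷ concat p → φ′ k p y ≡ σ → ψ′-Invertible σ
  ψ′-invertible-from refl ord letters inverse = ord , letters , inverse

  mutual
    φ′-invertible : ∀ x → Ordered cs → Unique (concat cs) → All (x ≢_) (concat cs) → φ′-Invertible cs x
    φ′-invertible x [] _ _ = cons [] [] [] , ↭-refl , refl
    φ′-invertible x o@(cons {h} {t} {rest} t<h rest<h ord) uniq x∉ with h <? x
    ... | yes h<x =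
      φ′-invertible-from (φ′-above o cs<x) (cons [] cs<x o) ↭-refl refl
      where cs<x = ordered-letters-< o h<x
    ... | no  h≮x =
      φ′-invertible-below (≤∧≢⇒< (≮⇒≥ h≮x) (All.head x∉)) (lengthCase t rest) t<h rest<h ord uniq

    φ′-invertible-below : x < h → LengthCase t rest →
                          All (_< h) t → All (_< h) (concat rest) → Ordered rest →
                          Unique (concat ((h ∷ t) ∷ rest)) → φ′-Invertible ((h ∷ t) ∷ rest) x
    φ′-invertible-below {x} {h} x<h (ℓ≡k {c} {more} ℓ) (c<h ∷ more<h) rest<h ord (_ ∷ c∉ ∷ u)
      with ord′ , letters , inverse ← φ′-invertible c ord (unique-++⁻ʳ more u) (All.++⁻ʳ more c∉) =
      φ′-invertible-from (φ′-eq-ℓ≡k x<h ℓ)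
        (cons (∷ʳ⁺ more<h x<h) (All-resp-↭ (↭-sym letters) (c<h ∷ rest<h)) ord′)
        (↭-trans (∷ʳ-++-↭ (h ∷ more) x _) (↭-prep x (↭-prep h (++-↭-∷ more letters))))
        (trans (ψ′-eq-ℓ≡k ℓ (isEmpty-concat-↭ letters))
               (cong (λ (p , y) → (h ∷ y ∷ more) ∷ p , x) inverse))
    φ′-invertible-below {x} {h} x<h (ℓ≡k∸1 {t} ℓ) t<h rest<h ord (_ ∷ u)
      with ord′ , letters , inverse ← ψ′-invertible ord (unique-++⁻ʳ t u) refl
      with y<h ∷ p<h ← All-resp-↭ letters rest<h =
      φ′-invertible-from (φ′-eq-ℓ≡k∸1 x<h ℓ refl)
        (cons (y<h ∷ ∷ʳ⁺ t<h x<h) p<h ord′)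
        (↭-trans (∷ʳ-++-↭ (h ∷ _ ∷ t) x _) (↭-prep x (↭-prep h (↭-sym (++-↭-∷ t letters)))))
        (trans (ψ′-eq-ℓ≡k+1 ℓ) (cong (λ rest → (h ∷ t) ∷ rest , x) inverse))
    φ′-invertible-below {x} {h} {t} x<h (other ℓ≢k ¬k∸1) t<h rest<h ord _ =
      φ′-invertible-from (φ′-eq-other x<h ℓ≢k ¬k∸1)
        (cons (∷ʳ⁺ t<h x<h) rest<h ord) (∷ʳ-++-↭ (h ∷ t) x _) (ψ′-eq-other ℓ≢k ¬k∸1)

    ψ′-invertible : ∀ {σ} → Ordered σ → Unique (concat σ) → isEmpty σ ≡ false → ψ′-Invertible σ
    ψ′-invertible (cons {h} {t} {rest} t<h rest<h ord) uniq _ with initLast t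
    ... | []      = ord , ↭-refl , φ′-above ord rest<h
    ... | i ∷ʳ′ z = ψ′-invertible-∷ʳ (lengthCase i rest) t<h rest<h ord uniq

    ψ′-invertible-∷ʳ : LengthCase t rest →
                       All (_< h) (t ∷ʳ z) → All (_< h) (concat rest) → Ordered rest →
                       Unique (concat ((h ∷ (t ∷ʳ z)) ∷ rest)) → ψ′-Invertible ((h ∷ (t ∷ʳ z)) ∷ rest)
    ψ′-invertible-∷ʳ {h = h} {z} (ℓ≡k {c} {more} ℓ) (c<h ∷ more∷ʳz<h) rest<h ord (_ ∷ c∉ ∷ u)
      with more<h , z<h ← ∷ʳ⁻ more∷ʳz<h
      with ord′ , letters , inverse ←
             φ′-invertible c ord (unique-++⁻ʳ (more ∷ʳ z) u) (All.++⁻ʳ (more ∷ʳ z) c∉) =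
      ψ′-invertible-from (ψ′-eq-ℓ≡k+1 ℓ)
        (cons more<h (All-resp-↭ (↭-sym letters) (c<h ∷ rest<h)) ord′)
        (↭-trans (∷ʳ-++-↭ (h ∷ c ∷ more) z _) (↭-prep z (↭-prep h (↭-sym (++-↭-∷ more letters)))))
        (trans (φ′-eq-ℓ≡k∸1 z<h ℓ (isEmpty-concat-↭ letters))
               (cong (λ (p , y) → (h ∷ y ∷ (more ∷ʳ z)) ∷ p) inverse))
    ψ′-invertible-∷ʳ {t} {h = h} {z} (ℓ≡k∸1 ℓ) t∷ʳz<h rest<h ord (_ ∷ u)
      with t<h , z<h ← ∷ʳ⁻ t∷ʳz<h
      with ord′ , letters , inverse ← ψ′-invertible ord (unique-++⁻ʳ (t ∷ʳ z) u) refl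
      with y<h ∷ p<h ← All-resp-↭ letters rest<h =
      ψ′-invertible-from (ψ′-eq-ℓ≡k ℓ refl)
        (cons (y<h ∷ t<h) p<h ord′)
        (↭-trans (∷ʳ-++-↭ (h ∷ t) z _) (↭-prep z (↭-prep h (++-↭-∷ t letters))))
        (trans (φ′-eq-ℓ≡k z<h ℓ) (cong (λ rest → (h ∷ (t ∷ʳ z)) ∷ rest) inverse))
    ψ′-invertible-∷ʳ {t} {h = h} {z} (other ℓ≢k ¬k∸1) t∷ʳz<h rest<h ord _
      with t<h , z<h ← ∷ʳ⁻ t∷ʳz<h =
      ψ′-invertible-from (ψ′-eq-other ℓ≢k ¬k∸1)
        (cons t<h rest<h ord) (∷ʳ-++-↭ (h ∷ t) z _) (φ′-eq-other z<h ℓ≢k ¬k∸1)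

  ψ∘φ : Canonical m π → 1 ≤ x → x ≤ suc m → Canonical (suc m) (φ k π x) × ψ k (φ k π x) ≡ (π , x)
  ψ∘φ {m} {π} {x} can@(_ , _ , π↭) 1≤x x≤1+m
    with ord , letters , inverse ← φ′-invertible x (incFrom-ordered x (canonical⇒ordered can))
                                     (incFrom-unique x π (unique-resp-↭ (↭-sym π↭) (range-unique m)))
                                     (incFrom-fresh x π) =
      ordered⇒canonical ord (begin
        concat (φ k π x)                 ↭⟨ letters ⟩
        x ∷ concat (incFrom x π)         ≡⟨ cong (x ∷_) (concat-map π) ⟩
        x ∷ map (incLetter x) (concat π) ↭⟨ ↭-prep x (map⁺ (incLetter x) π↭) ⟩
        x ∷ map (incLetter x) (range m)  ↭⟨ range-insert m 1≤x x≤1+m ⟩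
        range (suc m)                    ∎)
    , trans (cong (λ (p , y) → decAbove y p , y) inverse) (cong (_, x) (decAbove-incFrom x π))
    where open PermutationReasoning

  φ∘ψ : Canonical (suc m) σ →
        Canonical m (proj₁ (ψ k σ)) × 1 ≤ proj₂ (ψ k σ) × proj₂ (ψ k σ) ≤ suc m
        × φ k (proj₁ (ψ k σ)) (proj₂ (ψ k σ)) ≡ σ
  φ∘ψ {σ = []} (_ , _ , σ↭) = ⊥-elim (¬x∷xs↭[] (↭-sym σ↭))
  φ∘ψ {m} {σ = σ@(_ ∷ _)} can@(_ , _ , σ↭)
    with ord , letters , inverse ←
           ψ′-invertible (canonical⇒ordered can) (unique-resp-↭ (↭-sym σ↭) (range-unique (suc m))) refl
    with y∉ , 1≤y , y≤1+m , p↭ ← range-remove (↭-trans (↭-sym letters) σ↭) =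
      let (p , y) = ψ′ k σ in
      ordered⇒canonical (decAbove-ordered {cs = p} y∉ ord) (decAbove-range y p p↭) , 1≤y , y≤1+m
    , trans (cong (λ q → φ′ k q y) (incFrom-decAbove {cs = p} y∉)) inverse

lemma4p7 : (k : ℕ) → 2 ≤ k → (m : ℕ) →
    ((π : Cycles) (x : ℕ) → Canonical m π → 1 ≤ x → x ≤ suc m →
        Canonical (suc m) (φ k π x) × ψ k (φ k π x) ≡ (π , x))
    ×
    ((σ : Cycles) → Canonical (suc m) σ →
        Canonical m (proj₁ (ψ k σ)) × 1 ≤ proj₂ (ψ k σ) × proj₂ (ψ k σ) ≤ suc m
        × φ k (proj₁ (ψ k σ)) (proj₂ (ψ k σ)) ≡ σ)
lemma4p7 (suc zero)    (s≤s ()) _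
lemma4p7 (suc (suc j)) _        _ = (λ _ _ → ψ∘φ) , (λ _ → φ∘ψ)
  where open Bijection j
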